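{- For every randomized synchronous mutual search protocol for two agents on $n\ge 2$ sites that uses a bounded number of coin flips, the worst-case expected cost is at least $\frac{n-1}{8}$.
   Context: Sites are $V=\{0,\ldots,n-1\}$; two agents sit at two distinct sites and search for each other by queries "is there an agent at site $j$?". Time is discrete, with slots $t=1,2,\ldots$. A randomized synchronous mutual search protocol using a bounded number of coin flips is given by a number $b=b(n)$ and, for every site $i$ and every coin-flip string $\omega\in\{0,1\}^b$, a finite sequence $A(i,\omega)=(q_1,q_2,\ldots)$ with each $q_t\in\{\perp\}\cup(V\setminus\{i\})$, where $q_t=j$ means that an agent at $i$ with coin flips $\omega$ queries site $j$ in slot $t$, and $q_t=\perp$ means it makes no query in slot $t$ (before contact every answer is "no", so the schedule does not depend on answers). Both agents run this same protocol, each drawing its own string $\omega$ independently and uniformly at random. It is required that for all distinct sites $i,j$ and all $\omega,\omega'$, in each time slot at most one of $A(i,\omega)$, $A(j,\omega')$ has a non-$\perp$ entry, and that some slot contains a query of one of the two agents to the other's site. The cost of an execution with agents at $i,j$ using $\omega,\omega'$ is the number of non-$\perp$ queries of both agents in slots up to and including the first slot $t_0$ in which one agent queries the other's site. The worst-case expected cost of the protocol is the maximum over all placements $\{i,j\}$ of the expected cost over the random strings. -}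

module Defs where

open import Data.Nat using (ℕ; zero; suc; _+_; _*_)
open import Data.Bool using (Bool; true; false; if_then_else_; _∨_)
open import Data.Fin using (Fin)
open import Data.Fin.Properties renaming (_≟_ to _≟F_)
open import Data.Maybe using (Maybe; just; nothing)
open import Data.List using (List; []; _∷_; length; map; concatMap)
open import Data.Nat.ListAction using (sum)
open import Data.Vec using (Vec; []; _∷_)
open import Data.Product using (∃; _×_)
open import Data.Sum using (_⊎_)
open import Data.Empty using (⊥)
open import Relation.Binary.PropositionalEquality using (_≡_; _≢_)
open import Relation.Nullary using (does)

-- Query in slot t (slots indexed 0,1,2,...) of a finite schedule;
-- beyond the end of the sequence there is no query (⊥ = nothing).
slot : ∀ {n} → List (Maybe (Fin n)) → ℕ → Maybe (Fin n)
slot []       _       = nothing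
slot (q ∷ qs) zero    = q
slot (q ∷ qs) (suc t) = slot qs t

queries : ∀ {n} → List (Maybe (Fin n)) → ℕ → ℕ
queries l t with slot l t
... | nothing = 0
... | just _  = 1

queriesSite : ∀ {n} → List (Maybe (Fin n)) → ℕ → Fin n → Bool
queriesSite l t j with slot l t
... | nothing = false
... | just k  = does (k ≟F j)

record Protocol (n : ℕ) : Set where
  field
    b : ℕ
    A : Fin n → Vec Bool b → List (Maybe (Fin n))
    noSelf : ∀ i ω t j → slot (A i ω) t ≡ just j → j ≢ i
    exclusive : ∀ i j → i ≢ j → ∀ ω ω' t k k' →
      slot (A i ω) t ≡ just k → slot (A j ω') t ≡ just k' → ⊥
    meets : ∀ i j → i ≢ j → ∀ ω ω' → ∃ λ t →
      slot (A i ω) t ≡ just j ⊎ slot (A j ω') t ≡ just i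

-- The fuel length l₁ + length l₂ suffices since all queries (hence the first
-- hit) occur at slots < max (length l₁) (length l₂).
costAux : ∀ {n} → List (Maybe (Fin n)) → List (Maybe (Fin n)) →
          Fin n → Fin n → ℕ → ℕ → ℕ
costAux l₁ l₂ i j zero    t = 0
costAux l₁ l₂ i j (suc f) t =
  queries l₁ t + queries l₂ t +
  (if queriesSite l₁ t j ∨ queriesSite l₂ t i then 0 else costAux l₁ l₂ i j f (suc t))

cost : ∀ {n} (P : Protocol n) → Fin n → Fin n →
       Vec Bool (Protocol.b P) → Vec Bool (Protocol.b P) → ℕ
cost P i j ω ω' = costAux l₁ l₂ i j (length l₁ + length l₂) 0
  where
    l₁ = Protocol.A P i ω
    l₂ = Protocol.A P j ω'

allStrings : (b : ℕ) → List (Vec Bool b)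
allStrings zero    = [] ∷ []
allStrings (suc b) = concatMap (λ v → (false ∷ v) ∷ (true ∷ v) ∷ []) (allStrings b)

-- sum of the cost over all pairs of coin strings (= 2^(2b) · expected cost)
totalCost : ∀ {n} (P : Protocol n) → Fin n → Fin n → ℕ
totalCost P i j =
  sum (concatMap (λ ω → map (λ ω' → cost P i j ω ω') (allStrings (Protocol.b P)))
                 (allStrings (Protocol.b P)))

module Submission where

-- Let x = n − 1 and K = ⌊x/4⌋. If the agents at sites i ≠ j meet at cost at most K, the
-- meeting query is among the first K queries of its agent, so one agent's first K queries
-- contain the other's site. For a fixed site and coin string the first K queries cover at
-- most K sites, so summing over ordered pairs i ≠ j and over all coin strings gives
-- Σ_{i≠j} E[cost(i,j)] ≥ n(K+1)(x − 2K). If every pair had expected cost below x/8, this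
-- sum would be below n·x²/8, which the choice of K rules out.

open import Defs
open import Data.Nat using (ℕ; zero; suc; _+_; _*_; _∸_; _^_; _≤_; _<_; z≤n; s≤s; _≤?_; _/_; _%_)
open import Data.Nat.Properties hiding (_≟_)
open import Data.Nat.DivMod using (m≡m%n+[m/n]*n; m%n<n)
open import Data.Nat.Tactic.RingSolver using (solve-∀)
open import Algebra.Properties.Semiring.Sum +-*-semiring
  using (sum-syntax; ∑-distrib-+; ∑-comm; sum-cong-≗; *-distribˡ-sum)
import Data.Nat.ListAction as List
open import Data.Nat.ListAction.Properties using (sum-++)
open import Data.Bool using (Bool; true; false; if_then_else_; _∨_)
open import Data.Bool.Properties using (∨-zeroʳ)
open import Data.Fin using (Fin; zero; suc)
open import Data.Fin.Properties using (_≟_; any?)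
open import Data.Maybe using (Maybe; just; nothing)
open import Data.List using (List; []; _∷_; _++_; length; map; concatMap; take; drop; catMaybes; fromMaybe; lookup)
open import Data.List.Properties using (length-take)
open import Data.List.Membership.Propositional using (_∈_)
import Data.List.Membership.DecPropositional as DecMembership
open import Data.List.Relation.Unary.Any using (here; there)
open import Data.Vec using (Vec)
open import Data.Product using (Σ; _×_; _,_)
open import Data.Sum as Sum using (_⊎_; inj₁; inj₂)
open import Data.Empty using (⊥-elim)
open import Function using (_∘_)
open import Relation.Nullary using (Dec; does; yes; no; ¬_; ¬?; contradiction)
open import Relation.Nullary.Decidable using (_×-dec_)
open import Relation.Binary.PropositionalEquality

open module FinMembership {n} = DecMembership (_≟_ {n}) using (_∈?_)

∑-mono-≤ : ∀ {m} {f g : Fin m → ℕ} → (∀ i → f i ≤ g i) → ∑[ i < m ] f i ≤ ∑[ i < m ] g i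
∑-mono-≤ {zero}  f≤g = z≤n
∑-mono-≤ {suc m} f≤g = +-mono-≤ (f≤g zero) (∑-mono-≤ (f≤g ∘ suc))

∑-const : ∀ m c → ∑[ i < m ] c ≡ m * c
∑-const zero    c = refl
∑-const (suc m) c = cong (c +_) (∑-const m c)

∑-zero : ∀ m → ∑[ i < m ] 0 ≡ 0
∑-zero m = trans (∑-const m 0) (*-zeroʳ m)

indicator : {P : Set} → Dec P → ℕ
indicator P? = if does P? then 1 else 0

∑-indicator-≡ : ∀ {m} (k : Fin m) → ∑[ j < m ] indicator (j ≟ k) ≡ 1
∑-indicator-≡ {suc m} zero    = cong suc (∑-zero m)
∑-indicator-≡ {suc m} (suc k) = ∑-indicator-≡ k

∑-indicator-≢ : ∀ {m} (i : Fin (suc m)) → ∑[ j < suc m ] indicator (¬? (i ≟ j)) ≡ m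
∑-indicator-≢ {m}     zero    = trans (∑-const m 1) (*-identityʳ m)
∑-indicator-≢ {suc m} (suc i) = cong suc (∑-indicator-≢ i)

indicator-true : {P : Set} (P? : Dec P) → P → indicator P? ≡ 1
indicator-true (yes _)  _ = refl
indicator-true (no ¬p) p = contradiction p ¬p

∑-indicator-∈ : ∀ {m} (xs : List (Fin m)) → ∑[ j < m ] indicator (j ∈? xs) ≤ length xs
∑-indicator-∈ {m} [] = ≤-reflexive (∑-zero m)
∑-indicator-∈ {m} (x ∷ xs) = begin
  ∑[ j < m ] indicator (j ∈? x ∷ xs)                        ≤⟨ ∑-mono-≤ head-or-tail ⟩
  ∑[ j < m ] (indicator (j ≟ x) + indicator (j ∈? xs))      ≡⟨ ∑-distrib-+ (λ j → indicator (j ≟ x)) (λ j → indicator (j ∈? xs)) ⟩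
  ∑[ j < m ] indicator (j ≟ x) + ∑[ j < m ] indicator (j ∈? xs)
                                                            ≤⟨ +-mono-≤ (≤-reflexive (∑-indicator-≡ x)) (∑-indicator-∈ xs) ⟩
  suc (length xs)                                           ∎
  where
  open ≤-Reasoning
  head-or-tail : ∀ (j : Fin m) → indicator (j ∈? x ∷ xs) ≤ indicator (j ≟ x) + indicator (j ∈? xs)
  head-or-tail j with j ≟ x
  ... | yes _ = s≤s z≤n
  ... | no  _ = ≤-refl

∑² : ∀ m m′ → (Fin m → Fin m′ → ℕ) → ℕ
∑² m m′ f = ∑[ k < m ] ∑[ k′ < m′ ] f k k′

module _ {m m′ : ℕ} where
  open ≡-Reasoning

  ∑²-mono-≤ : {f g : Fin m → Fin m′ → ℕ} → (∀ k k′ → f k k′ ≤ g k k′) → ∑² m m′ f ≤ ∑² m m′ g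
  ∑²-mono-≤ f≤g = ∑-mono-≤ (λ k → ∑-mono-≤ (f≤g k))

  ∑²-distrib-+ : (f g : Fin m → Fin m′ → ℕ) →
    ∑² m m′ (λ k k′ → f k k′ + g k k′) ≡ ∑² m m′ f + ∑² m m′ g
  ∑²-distrib-+ f g = begin
    ∑[ k < m ] ∑[ k′ < m′ ] (f k k′ + g k k′)              ≡⟨ sum-cong-≗ {m} (λ k → ∑-distrib-+ (f k) (g k)) ⟩
    ∑[ k < m ] (∑[ k′ < m′ ] f k k′ + ∑[ k′ < m′ ] g k k′)  ≡⟨ ∑-distrib-+ (λ k → ∑[ k′ < m′ ] f k k′) _ ⟩
    ∑² m m′ f + ∑² m m′ g                                  ∎

  ∑²-*ˡ : ∀ c (f : Fin m → Fin m′ → ℕ) → ∑² m m′ (λ k k′ → c * f k k′) ≡ c * ∑² m m′ f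
  ∑²-*ˡ c f = begin
    ∑[ k < m ] ∑[ k′ < m′ ] (c * f k k′)  ≡⟨ sum-cong-≗ {m} (λ k → *-distribˡ-sum c (f k)) ⟨
    ∑[ k < m ] (c * ∑[ k′ < m′ ] f k k′)  ≡⟨ *-distribˡ-sum c (λ k → ∑[ k′ < m′ ] f k k′) ⟨
    c * ∑² m m′ f                         ∎

  ∑²-separable : (f : Fin m → ℕ) (g : Fin m′ → ℕ) →
    ∑² m m′ (λ k k′ → f k + g k′) ≡ m′ * ∑[ k < m ] f k + m * ∑[ k′ < m′ ] g k′
  ∑²-separable f g = begin
    ∑² m m′ (λ k k′ → f k + g k′)               ≡⟨ ∑²-distrib-+ (λ k _ → f k) (λ _ k′ → g k′) ⟩
    ∑² m m′ (λ k _ → f k) + Σg                  ≡⟨ cong (_+ Σg) (sum-cong-≗ {m} (λ k → ∑-const m′ (f k))) ⟩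
    ∑[ k < m ] (m′ * f k) + Σg                  ≡⟨ cong (_+ Σg) (*-distribˡ-sum m′ f) ⟨
    m′ * ∑[ k < m ] f k + Σg                    ≡⟨ cong (m′ * ∑[ k < m ] f k +_) (∑-const m (∑[ k′ < m′ ] g k′)) ⟩
    m′ * ∑[ k < m ] f k + m * ∑[ k′ < m′ ] g k′  ∎
    where Σg = ∑² m m′ (λ _ k′ → g k′)

∑²-const : ∀ m m′ c → ∑² m m′ (λ _ _ → c) ≡ m * (m′ * c)
∑²-const m m′ c = trans (sum-cong-≗ {m} (λ _ → ∑-const m′ c)) (∑-const m (m′ * c))

∑²-symmetrise : ∀ {m} (f : Fin m → Fin m → ℕ) → ∑² m m (λ k k′ → f k k′ + f k′ k) ≡ ∑² m m f + ∑² m m f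
∑²-symmetrise f = trans (∑²-distrib-+ f (λ k k′ → f k′ k)) (cong (∑² _ _ f +_) (∑-comm (λ k k′ → f k′ k)))

sum-map≡∑-lookup : ∀ {A : Set} (f : A → ℕ) (xs : List A) →
  List.sum (map f xs) ≡ ∑[ k < length xs ] f (lookup xs k)
sum-map≡∑-lookup f []       = refl
sum-map≡∑-lookup f (x ∷ xs) = cong (f x +_) (sum-map≡∑-lookup f xs)

sum-concatMap≡∑² : ∀ {A : Set} (g : A → A → ℕ) (xs ys : List A) →
  List.sum (concatMap (λ x → map (g x) ys) xs) ≡ ∑² (length xs) (length ys) (λ k k′ → g (lookup xs k) (lookup ys k′))
sum-concatMap≡∑² g []       ys = refl
sum-concatMap≡∑² g (x ∷ xs) ys = trans
  (sum-++ (map (g x) ys) (concatMap (λ x → map (g x) ys) xs))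
  (cong₂ _+_ (sum-map≡∑-lookup (g x) ys) (sum-concatMap≡∑² g xs ys))

length-concatMap-pair : ∀ {A B : Set} (f g : A → B) (xs : List A) →
  length (concatMap (λ x → f x ∷ g x ∷ []) xs) ≡ 2 * length xs
length-concatMap-pair f g []       = refl
length-concatMap-pair f g (x ∷ xs) = cong suc (trans (cong suc (length-concatMap-pair f g xs))
                                                     (sym (+-suc (length xs) (length xs + 0))))

length-allStrings : ∀ b → length (allStrings b) ≡ 2 ^ b
length-allStrings zero    = refl
length-allStrings (suc b) = trans (length-concatMap-pair _ _ (allStrings b))
                                  (cong (2 *_) (length-allStrings b))

module _ {A : Set} {x : A} where

  ∈-take-mono : ∀ {m m′} (xs : List A) → x ∈ take m xs → m ≤ m′ → x ∈ take m′ xs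
  ∈-take-mono (y ∷ ys) (here x≡y)  (s≤s _)    = here x≡y
  ∈-take-mono (y ∷ ys) (there x∈ys) (s≤s m≤m′) = there (∈-take-mono ys x∈ys m≤m′)

  ∈-take-++ˡ : ∀ {zs ys : List A} {c} → x ∈ zs → length zs ≤ c → x ∈ take c (zs ++ ys)
  ∈-take-++ˡ (here x≡z)   (s≤s _)   = here x≡z
  ∈-take-++ˡ (there x∈zs) (s≤s len≤c) = there (∈-take-++ˡ x∈zs len≤c)

  ∈-take-++ʳ : ∀ (zs : List A) {ys m c} → x ∈ take m ys → length zs + m ≤ c → x ∈ take c (zs ++ ys)
  ∈-take-++ʳ []       x∈ys le       = ∈-take-mono _ x∈ys le
  ∈-take-++ʳ (z ∷ zs) x∈ys (s≤s le) = there (∈-take-++ʳ zs x∈ys le)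

module _ {n : ℕ} where

  isQueryTo : Maybe (Fin n) → Fin n → Bool
  isQueryTo nothing  j = false
  isQueryTo (just k) j = does (k ≟ j)

  isQueryTo-just : ∀ j → isQueryTo (just j) j ≡ true
  isQueryTo-just j with j ≟ j
  ... | yes _  = refl
  ... | no j≢j = ⊥-elim (j≢j refl)

  isQueryTo⇒∈ : ∀ h j → isQueryTo h j ≡ true → j ∈ fromMaybe h
  isQueryTo⇒∈ (just k) j hit with k ≟ j
  isQueryTo⇒∈ (just k) j refl | yes k≡j = here (sym k≡j)

  queries≡ : ∀ (l : List (Maybe (Fin n))) t → queries l t ≡ length (fromMaybe (slot l t))
  queries≡ l t with slot l t
  ... | nothing = refl
  ... | just _  = refl

  queriesSite≡ : ∀ (l : List (Maybe (Fin n))) t j → queriesSite l t j ≡ isQueryTo (slot l t) j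
  queriesSite≡ l t j with slot l t
  ... | nothing = refl
  ... | just _  = refl

  slot-suc : ∀ (l : List (Maybe (Fin n))) t → slot l (suc t) ≡ slot (drop 1 l) t
  slot-suc []      t = refl
  slot-suc (_ ∷ _) t = refl

  slot-just⇒< : ∀ (l : List (Maybe (Fin n))) t {k} → slot l t ≡ just k → t < length l
  slot-just⇒< (_ ∷ l) zero    _  = s≤s z≤n
  slot-just⇒< (_ ∷ l) (suc t) eq = s≤s (slot-just⇒< l t eq)

  meeting-slot< : ∀ (l₁ l₂ : List (Maybe (Fin n))) t {i j} →
    slot l₁ t ≡ just j ⊎ slot l₂ t ≡ just i → t < length l₁ + length l₂
  meeting-slot< l₁ l₂ t (inj₁ eq) = ≤-trans (slot-just⇒< l₁ t eq) (m≤m+n _ _)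
  meeting-slot< l₁ l₂ t (inj₂ eq) = ≤-trans (slot-just⇒< l₂ t eq) (m≤n+m _ _)

  catMaybes-slot : ∀ (l : List (Maybe (Fin n))) → catMaybes l ≡ fromMaybe (slot l 0) ++ catMaybes (drop 1 l)
  catMaybes-slot []            = refl
  catMaybes-slot (nothing ∷ l) = refl
  catMaybes-slot (just _  ∷ l) = refl

  queries-suc : ∀ (l : List (Maybe (Fin n))) t → queries l (suc t) ≡ queries (drop 1 l) t
  queries-suc l t = begin
    queries l (suc t)                          ≡⟨ queries≡ l (suc t) ⟩
    length (fromMaybe (slot l (suc t)))        ≡⟨ cong (length ∘ fromMaybe) (slot-suc l t) ⟩
    length (fromMaybe (slot (drop 1 l) t))     ≡⟨ queries≡ (drop 1 l) t ⟨
    queries (drop 1 l) t                       ∎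
    where open ≡-Reasoning

  queriesSite-suc : ∀ (l : List (Maybe (Fin n))) t j → queriesSite l (suc t) j ≡ queriesSite (drop 1 l) t j
  queriesSite-suc l t j = begin
    queriesSite l (suc t) j                    ≡⟨ queriesSite≡ l (suc t) j ⟩
    isQueryTo (slot l (suc t)) j               ≡⟨ cong (λ h → isQueryTo h j) (slot-suc l t) ⟩
    isQueryTo (slot (drop 1 l) t) j            ≡⟨ queriesSite≡ (drop 1 l) t j ⟨
    queriesSite (drop 1 l) t j                 ∎
    where open ≡-Reasoning

  costAux-suc : ∀ (l₁ l₂ : List (Maybe (Fin n))) i j f t →
    costAux l₁ l₂ i j f (suc t) ≡ costAux (drop 1 l₁) (drop 1 l₂) i j f t
  costAux-suc l₁ l₂ i j zero    t = refl
  costAux-suc l₁ l₂ i j (suc f) t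
    rewrite queries-suc l₁ t | queries-suc l₂ t | queriesSite-suc l₁ t j | queriesSite-suc l₂ t i
          | costAux-suc l₁ l₂ i j f (suc t) = refl

  costAux-unfold : ∀ (l₁ l₂ : List (Maybe (Fin n))) i j f → costAux l₁ l₂ i j (suc f) 0 ≡
    length (fromMaybe (slot l₁ 0)) + length (fromMaybe (slot l₂ 0)) +
    (if isQueryTo (slot l₁ 0) j ∨ isQueryTo (slot l₂ 0) i then 0
     else costAux (drop 1 l₁) (drop 1 l₂) i j f 0)
  costAux-unfold l₁ l₂ i j f
    rewrite queries≡ l₁ 0 | queries≡ l₂ 0 | queriesSite≡ l₁ 0 j | queriesSite≡ l₂ 0 i
          | costAux-suc l₁ l₂ i j f 0 = refl

  MeetsWithin : ℕ → List (Maybe (Fin n)) → List (Maybe (Fin n)) → Fin n → Fin n → Set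
  MeetsWithin c l₁ l₂ i j = j ∈ take c (catMaybes l₁) ⊎ i ∈ take c (catMaybes l₂)

  MeetsWithin-mono : ∀ {c c′ l₁ l₂ i j} → MeetsWithin c l₁ l₂ i j → c ≤ c′ → MeetsWithin c′ l₁ l₂ i j
  MeetsWithin-mono {l₁ = l₁} (inj₁ j∈) c≤c′ = inj₁ (∈-take-mono (catMaybes l₁) j∈ c≤c′)
  MeetsWithin-mono {l₂ = l₂} (inj₂ i∈) c≤c′ = inj₂ (∈-take-mono (catMaybes l₂) i∈ c≤c′)

  module _ (i j : Fin n) where

    meets-at-head : ∀ h₁ h₂ (ts₁ ts₂ : List (Fin n)) R →
      (isQueryTo h₁ j ∨ isQueryTo h₂ i ≡ false → j ∈ take R ts₁ ⊎ i ∈ take R ts₂) →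
      let c = length (fromMaybe h₁) + length (fromMaybe h₂) + (if isQueryTo h₁ j ∨ isQueryTo h₂ i then 0 else R)
      in j ∈ take c (fromMaybe h₁ ++ ts₁) ⊎ i ∈ take c (fromMaybe h₂ ++ ts₂)
    meets-at-head h₁ h₂ ts₁ ts₂ R later with isQueryTo h₁ j in hit₁ | isQueryTo h₂ i in hit₂
    ... | true  | _    = inj₁ (∈-take-++ˡ (isQueryTo⇒∈ h₁ j hit₁)
                                (≤-trans (m≤m+n _ (length (fromMaybe h₂))) (m≤m+n _ 0)))
    ... | false | true = inj₂ (∈-take-++ˡ (isQueryTo⇒∈ h₂ i hit₂)
                                (≤-trans (m≤n+m _ (length (fromMaybe h₁))) (m≤m+n _ 0)))
    ... | false | false with later refl
    ...   | inj₁ j∈ = inj₁ (∈-take-++ʳ (fromMaybe h₁) j∈ (+-monoˡ-≤ R (m≤m+n _ (length (fromMaybe h₂)))))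
    ...   | inj₂ i∈ = inj₂ (∈-take-++ʳ (fromMaybe h₂) i∈ (+-monoˡ-≤ R (m≤n+m _ (length (fromMaybe h₁)))))

    meets-within-cost : ∀ f (l₁ l₂ : List (Maybe (Fin n))) t → t < f →
      slot l₁ t ≡ just j ⊎ slot l₂ t ≡ just i → MeetsWithin (costAux l₁ l₂ i j f 0) l₁ l₂ i j
    meets-within-cost (suc f) l₁ l₂ t t<f hit
      rewrite costAux-unfold l₁ l₂ i j f | catMaybes-slot l₁ | catMaybes-slot l₂
      = meets-at-head (slot l₁ 0) (slot l₂ 0) _ _ _ (later t t<f hit)
      where
      hit-now : slot l₁ 0 ≡ just j ⊎ slot l₂ 0 ≡ just i → isQueryTo (slot l₁ 0) j ∨ isQueryTo (slot l₂ 0) i ≡ true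
      hit-now (inj₁ eq) rewrite eq | isQueryTo-just j = refl
      hit-now (inj₂ eq) rewrite eq | isQueryTo-just i = ∨-zeroʳ (isQueryTo (slot l₁ 0) j)

      later : ∀ t → t < suc f → slot l₁ t ≡ just j ⊎ slot l₂ t ≡ just i →
        isQueryTo (slot l₁ 0) j ∨ isQueryTo (slot l₂ 0) i ≡ false →
        MeetsWithin (costAux (drop 1 l₁) (drop 1 l₂) i j f 0) (drop 1 l₁) (drop 1 l₂) i j
      later zero    _         hit miss = contradiction (trans (sym (hit-now hit)) miss) λ ()
      later (suc t) (s≤s t<f) hit miss = meets-within-cost f (drop 1 l₁) (drop 1 l₂) t t<f
        (Sum.map (trans (sym (slot-suc l₁ t))) (trans (sym (slot-suc l₂ t))) hit)

offDiagonal : ∀ {n} → Fin n → Fin n → ℕ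
offDiagonal i j = indicator (¬? (i ≟ j))

∑²-offDiagonal : ∀ m → ∑² (suc m) (suc m) offDiagonal ≡ suc m * m
∑²-offDiagonal m = trans (sum-cong-≗ {suc m} ∑-indicator-≢) (∑-const (suc m) m)

module EarlyQueries {n : ℕ} (P : Protocol n) (K : ℕ) where
  open Protocol P

  coins : List (Vec Bool b)
  coins = allStrings b

  B : ℕ
  B = length coins

  coin : Fin B → Vec Bool b
  coin = lookup coins

  firstQueries : Fin n → Vec Bool b → List (Fin n)
  firstQueries i ω = take K (catMaybes (A i ω))

  early : Fin n → Fin n → Vec Bool b → ℕ
  early i j ω = indicator (j ∈? firstQueries i ω)

  earlyCount : Fin n → Fin n → ℕ
  earlyCount i j = ∑[ k < B ] early i j (coin k)

  cheap-execution-meets-early : ∀ {i j} → i ≢ j → ∀ ω ω′ →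
    cost P i j ω ω′ ≤ K → 1 ≤ early i j ω + early j i ω′
  cheap-execution-meets-early {i} {j} i≢j ω ω′ cost≤K
    with meets i j i≢j ω ω′
  ... | t , hit with MeetsWithin-mono {l₁ = A i ω} {l₂ = A j ω′}
                      (meets-within-cost i j _ (A i ω) (A j ω′) t (meeting-slot< (A i ω) (A j ω′) t hit) hit) cost≤K
  ... | inj₁ j∈ = ≤-trans (≤-reflexive (sym (indicator-true (j ∈? firstQueries i ω) j∈))) (m≤m+n _ _)
  ... | inj₂ i∈ = ≤-trans (≤-reflexive (sym (indicator-true (i ∈? firstQueries j ω′) i∈))) (m≤n+m _ _)

  costly-or-early : ∀ i j ω ω′ → offDiagonal i j * suc K ≤
    offDiagonal i j * cost P i j ω ω′ + suc K * (early i j ω + early j i ω′)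
  costly-or-early i j ω ω′ with i ≟ j
  ... | yes _   = z≤n
  ... | no i≢j with cost P i j ω ω′ ≤? K
  ...   | yes cost≤K = ≤-trans (≤-reflexive (*-comm 1 (suc K)))
                        (≤-trans (*-monoʳ-≤ (suc K) (cheap-execution-meets-early i≢j ω ω′ cost≤K))
                                 (m≤n+m _ (1 * cost P i j ω ω′)))
  ...   | no cost≰K  = ≤-trans (*-monoʳ-≤ 1 (≰⇒> cost≰K)) (m≤m+n _ (suc K * (early i j ω + early j i ω′)))

  totalCost≡∑² : ∀ i j → totalCost P i j ≡ ∑² B B (λ k k′ → cost P i j (coin k) (coin k′))
  totalCost≡∑² i j = sum-concatMap≡∑² (cost P i j) coins coins

  pair-bound : ∀ i j → B * (B * suc K) * offDiagonal i j ≤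
    offDiagonal i j * totalCost P i j + suc K * (B * earlyCount i j + B * earlyCount j i)
  pair-bound i j = begin
    B * (B * suc K) * d                                        ≡⟨ reassociate ⟩
    B * (B * (d * suc K))                                      ≡⟨ ∑²-const B B (d * suc K) ⟨
    ∑² B B (λ _ _ → d * suc K)                                 ≤⟨ ∑²-mono-≤ (λ k k′ → costly-or-early i j (coin k) (coin k′)) ⟩
    ∑² B B (λ k k′ → d * c k k′ + suc K * ee′ k k′)            ≡⟨ ∑²-distrib-+ (λ k k′ → d * c k k′) _ ⟩
    ∑² B B (λ k k′ → d * c k k′) + ∑² B B (λ k k′ → suc K * ee′ k k′)
                                                               ≡⟨ cong₂ _+_ (∑²-*ˡ d c) (∑²-*ˡ (suc K) ee′) ⟩
    d * ∑² B B c + suc K * ∑² B B ee′                          ≡⟨ cong₂ (λ u v → d * u + suc K * v)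
                                                                        (sym (totalCost≡∑² i j)) (∑²-separable e e′) ⟩
    d * totalCost P i j + suc K * (B * earlyCount i j + B * earlyCount j i) ∎
    where
    open ≤-Reasoning
    d = offDiagonal i j
    c = λ k k′ → cost P i j (coin k) (coin k′)
    e = λ k → early i j (coin k)
    e′ = λ k′ → early j i (coin k′)
    ee′ = λ k k′ → e k + e′ k′
    reassociate : B * (B * suc K) * d ≡ B * (B * (d * suc K))
    reassociate = trans (*-assoc B (B * suc K) d)
                        (cong (B *_) (trans (*-assoc B (suc K) d) (cong (B *_) (*-comm (suc K) d))))

  ∑-early-≤ : ∀ i ω → ∑[ j < n ] early i j ω ≤ K
  ∑-early-≤ i ω = ≤-trans (∑-indicator-∈ (firstQueries i ω))
                          (≤-trans (≤-reflexive (length-take K (catMaybes (A i ω)))) (m⊓n≤m K _))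

  ∑²-earlyCount-≤ : ∑² n n earlyCount ≤ n * (B * K)
  ∑²-earlyCount-≤ = begin
    ∑² n n earlyCount                                 ≡⟨ sum-cong-≗ {n} (λ i → ∑-comm (λ j k → early i j (coin k))) ⟩
    ∑² n B (λ i k → ∑[ j < n ] early i j (coin k))    ≤⟨ ∑²-mono-≤ (λ i k → ∑-early-≤ i (coin k)) ⟩
    ∑² n B (λ _ _ → K)                                ≡⟨ ∑²-const n B K ⟩
    n * (B * K)                                       ∎
    where open ≤-Reasoning

-- (x − 4K)(x − 4K − 4) ≤ 0 for K = ⌊x/4⌋, since 4K ≤ x < 4K + 4.
quarter-bound : ∀ x → x * x + 16 * (x / 4 * suc (x / 4)) ≤ 8 * (suc (x / 4) * x)
quarter-bound x = subst (λ y → y * y + 16 * (q * suc q) ≤ 8 * (suc q * y)) (sym (m≡m%n+[m/n]*n x 4))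
  (+-cancelʳ-≤ (16 * q + 8 * r) _ _ (begin
    (r + q * 4) * (r + q * 4) + 16 * (q * suc q) + (16 * q + 8 * r)  ≡⟨ expand r q ⟩
    8 * (suc q * (r + q * 4)) + r * r                                ≤⟨ +-monoʳ-≤ _ r*r≤ ⟩
    8 * (suc q * (r + q * 4)) + (16 * q + 8 * r)                     ∎))
  where
  open ≤-Reasoning
  q = x / 4
  r = x % 4
  expand : ∀ r q → (r + q * 4) * (r + q * 4) + 16 * (q * suc q) + (16 * q + 8 * r)
                   ≡ 8 * (suc q * (r + q * 4)) + r * r
  expand = solve-∀
  r≤8 : r ≤ 8
  r≤8 = ≤-trans (<⇒≤ (m%n<n x 4)) (+-monoʳ-≤ 4 z≤n)
  r*r≤ : r * r ≤ 16 * q + 8 * r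
  r*r≤ = ≤-trans (*-monoˡ-≤ r r≤8) (m≤n+m (8 * r) (16 * q))

lower-bound-arithmetic : ∀ N x S B K →
  B * (B * suc K) * (N * x) ≤ S + suc K * (B * (N * (B * K)) + B * (N * (B * K))) →
  8 * S + N * x ≤ x * (B * B) * (N * x) →
  x * x + 16 * (K * suc K) ≤ 8 * (suc K * x) →
  N * x ≤ 0
lower-bound-arithmetic N x S B K cost≥ cost< quadratic = +-cancelʳ-≤ (8 * X) (N * x) 0 (begin
    N * x + 8 * X                                ≤⟨ +-monoʳ-≤ (N * x) (*-monoʳ-≤ 8 cost≥) ⟩
    N * x + 8 * (S + suc K * (Y + Y))             ≡⟨ regroup N x S B K ⟩
    (8 * S + N * x) + 16 * (suc K * Y)            ≤⟨ +-monoˡ-≤ _ cost< ⟩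
    x * (B * B) * (N * x) + 16 * (suc K * Y)      ≡⟨ factor N x B K ⟩
    N * (B * B) * (x * x + 16 * (K * suc K))      ≤⟨ *-monoʳ-≤ (N * (B * B)) quadratic ⟩
    N * (B * B) * (8 * (suc K * x))               ≡⟨ unfactor N x B K ⟩
    0 + 8 * X                                     ∎)
  where
  open ≤-Reasoning
  X = B * (B * suc K) * (N * x)
  Y = B * (N * (B * K))
  regroup : ∀ N x S B K → N * x + 8 * (S + suc K * (B * (N * (B * K)) + B * (N * (B * K))))
                          ≡ (8 * S + N * x) + 16 * (suc K * (B * (N * (B * K))))
  regroup = solve-∀
  factor : ∀ N x B K → x * (B * B) * (N * x) + 16 * (suc K * (B * (N * (B * K))))
                       ≡ N * (B * B) * (x * x + 16 * (K * suc K))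
  factor = solve-∀
  unfactor : ∀ N x B K → N * (B * B) * (8 * (suc K * x)) ≡ 0 + 8 * (B * (B * suc K) * (N * x))
  unfactor = solve-∀

module Averaging {x : ℕ} (P : Protocol (suc x)) where
  open Protocol P using (b)

  K : ℕ
  K = x / 4

  open EarlyQueries P K public

  weightedCost : ℕ
  weightedCost = ∑² (suc x) (suc x) (λ i j → offDiagonal i j * totalCost P i j)

  weightedCost-≥ : B * (B * suc K) * (suc x * x) ≤
    weightedCost + suc K * (B * (suc x * (B * K)) + B * (suc x * (B * K)))
  weightedCost-≥ = begin
    B * (B * suc K) * (n * x)                           ≡⟨ cong (B * (B * suc K) *_) (∑²-offDiagonal x) ⟨
    B * (B * suc K) * ∑² n n d                          ≡⟨ ∑²-*ˡ (B * (B * suc K)) d ⟨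
    ∑² n n (λ i j → B * (B * suc K) * d i j)            ≤⟨ ∑²-mono-≤ pair-bound ⟩
    ∑² n n (λ i j → d i j * totalCost P i j + suc K * e i j)
                                                        ≡⟨ ∑²-distrib-+ (λ i j → d i j * totalCost P i j) (λ i j → suc K * e i j) ⟩
    weightedCost + ∑² n n (λ i j → suc K * e i j)       ≡⟨ cong (weightedCost +_) (∑²-*ˡ (suc K) e) ⟩
    weightedCost + suc K * ∑² n n e                     ≡⟨ cong (λ v → weightedCost + suc K * v) ∑²-e ⟩
    weightedCost + suc K * (B * E + B * E)              ≤⟨ +-monoʳ-≤ weightedCost (*-monoʳ-≤ (suc K)
                                                             (+-mono-≤ (*-monoʳ-≤ B ∑²-earlyCount-≤) (*-monoʳ-≤ B ∑²-earlyCount-≤))) ⟩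
    weightedCost + suc K * (B * (n * (B * K)) + B * (n * (B * K))) ∎
    where
    open ≤-Reasoning
    n = suc x
    d = offDiagonal {n}
    e = λ i j → B * earlyCount i j + B * earlyCount j i
    E = ∑² n n earlyCount
    ∑²-e : ∑² n n e ≡ B * E + B * E
    ∑²-e = trans (∑²-symmetrise (λ i j → B * earlyCount i j)) (cong₂ _+_ (∑²-*ˡ B earlyCount) (∑²-*ˡ B earlyCount))

  Good : Fin (suc x) → Fin (suc x) → Set
  Good i j = i ≢ j × x * (2 ^ b * 2 ^ b) ≤ 8 * totalCost P i j

  no-good-pair⇒weightedCost-< : (∀ i j → ¬ Good i j) →
    8 * weightedCost + suc x * x ≤ x * (B * B) * (suc x * x)
  no-good-pair⇒weightedCost-< none-good = begin
    8 * weightedCost + n * x                                      ≡⟨ cong₂ _+_ (∑²-*ˡ 8 c) (∑²-offDiagonal x) ⟨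
    ∑² n n (λ i j → 8 * c i j) + ∑² n n d                         ≡⟨ ∑²-distrib-+ (λ i j → 8 * c i j) d ⟨
    ∑² n n (λ i j → 8 * c i j + d i j)                            ≤⟨ ∑²-mono-≤ pair-bad ⟩
    ∑² n n (λ i j → x * (B * B) * d i j)                          ≡⟨ ∑²-*ˡ (x * (B * B)) d ⟩
    x * (B * B) * ∑² n n d                                        ≡⟨ cong (x * (B * B) *_) (∑²-offDiagonal x) ⟩
    x * (B * B) * (n * x)                                         ∎
    where
    open ≤-Reasoning
    n = suc x
    d = offDiagonal {n}
    c = λ i j → d i j * totalCost P i j
    pair-bad : ∀ i j → 8 * c i j + d i j ≤ x * (B * B) * d i j
    pair-bad i j with i ≟ j
    ... | yes _  = z≤n
    ... | no i≢j rewrite length-allStrings b | +-identityʳ (totalCost P i j) | *-identityʳ (x * (2 ^ b * 2 ^ b))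
      = subst (_≤ x * (2 ^ b * 2 ^ b)) (+-comm 1 _) (≰⇒> (λ good → none-good i j (i≢j , good)))

theorem5 : (n : ℕ) → 2 ≤ n → (P : Protocol n) →
    Σ (Fin n) λ i → Σ (Fin n) λ j →
      i ≢ j × (n ∸ 1) * (2 ^ Protocol.b P * 2 ^ Protocol.b P) ≤ 8 * totalCost P i j
theorem5 (suc (suc m)) _ P with any? (λ i → any? (λ j → ¬? (i ≟ j) ×-dec (_ ≤? 8 * totalCost P i j)))
... | yes good = good
... | no  none = contradiction
  (lower-bound-arithmetic (suc (suc m)) (suc m) weightedCost B K
    weightedCost-≥ (no-good-pair⇒weightedCost-< (λ i j good → none (i , j , good))) (quarter-bound (suc m)))
  λ ()
  where
  open Averaging P
theorem5 (suc zero) (s≤s ()) P
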